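{- For every $n\geq 1$, the number of shallow $123$-avoiding involutions of length $n$ is $\lfloor n^2/4 \rfloor +1$.
   Context: For $\pi=\pi_1\cdots\pi_n \in S_n$: $D(\pi)=\sum_{i=1}^n|\pi_i-i|$; $I(\pi)=|\{(i,j): i<j,\ \pi_i>\pi_j\}|$; $T(\pi)=n-\mathrm{cyc}(\pi)$ where $\mathrm{cyc}(\pi)$ is the number of cycles of $\pi$. $\pi$ is shallow if $I(\pi)+T(\pi)=D(\pi)$. $\pi$ avoids $123$ if there are no $i<j<k$ with $\pi_i<\pi_j<\pi_k$. An involution is a permutation with $\pi=\pi^{ -1}$. -}

module Defs where

open import Data.Nat using (ℕ; zero; suc; _+_; _∸_; _*_; _/_; _<_; _≤_; _<?_; _≤?_)
open import Data.Nat.Properties using (_≟_)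
open import Data.Fin using (Fin; toℕ)
import Data.Fin.Properties as FinP
open import Data.Vec using (Vec; []; _∷_; lookup)
open import Data.List using (List; []; _∷_; map; concatMap; filter; length; allFin; cartesianProduct)
open import Data.Product using (_×_; _,_; proj₁; proj₂)
open import Relation.Binary.PropositionalEquality using (_≡_)
open import Relation.Nullary using (¬_; Dec)
open import Relation.Nullary.Decidable using (_×-dec_; ¬?; _→-dec_)
open import Relation.Unary using (Decidable)

-- A permutation π = π₁ ⋯ πₙ of length n is represented in one-line notation
-- as a vector v : Vec (Fin n) n whose entries are pairwise distinct.
-- Positions and values are 0-based (i ↦ i-1); all statistics below are
-- invariant under this uniform shift.

Word : ℕ → Set
Word n = Vec (Fin n) n

val : ∀ {n} → Word n → Fin n → ℕ
val v i = toℕ (lookup v i)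

words : (n m : ℕ) → List (Vec (Fin n) m)
words n zero    = [] ∷ []
words n (suc m) = concatMap (λ x → map (x ∷_) (words n m)) (allFin n)

IsPerm : ∀ {n} → Word n → Set
IsPerm v = ∀ i j → lookup v i ≡ lookup v j → i ≡ j

IsInvolution : ∀ {n} → Word n → Set
IsInvolution v = ∀ i → lookup v (lookup v i) ≡ i

Avoids123 : ∀ {n} → Word n → Set
Avoids123 v = ∀ i j k → toℕ i < toℕ j → toℕ j < toℕ k →
  ¬ (val v i < val v j × val v j < val v k)

dist : ℕ → ℕ → ℕ
dist a b = (a ∸ b) + (b ∸ a)

sumFin : ∀ {n} → (Fin n → ℕ) → ℕ
sumFin {n} f = go (allFin n)
  where
  go : List (Fin n) → ℕ
  go []       = 0
  go (x ∷ xs) = f x + go xs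

Dstat : ∀ {n} → Word n → ℕ
Dstat v = sumFin (λ i → dist (val v i) (toℕ i))

Istat : ∀ {n} → Word n → ℕ
Istat {n} v = length (filter inv? (cartesianProduct (allFin n) (allFin n)))
  where
  inv? : Decidable (λ (p : Fin n × Fin n) →
           toℕ (proj₁ p) < toℕ (proj₂ p) × val v (proj₂ p) < val v (proj₁ p))
  inv? (i , j) = (toℕ i <? toℕ j) ×-dec (val v j <? val v i)

iter : ∀ {n} → Word n → ℕ → Fin n → Fin n
iter v zero    i = i
iter v (suc k) i = lookup v (iter v k i)

-- i is the least element of its cycle: π^k(i) ≥ i for all 1 ≤ k ≤ n
-- (every cycle has length ≤ n, so this ranges over the whole cycle)
IsCycleMin : ∀ {n} → Word n → Fin n → Set
IsCycleMin {n} v i = ∀ (k : Fin n) → toℕ i ≤ toℕ (iter v (suc (toℕ k)) i)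

isCycleMin? : ∀ {n} (v : Word n) → Decidable (IsCycleMin v)
isCycleMin? v i = FinP.all? (λ k → toℕ i ≤? toℕ (iter v (suc (toℕ k)) i))

-- cyc(π) = number of cycles = number of cycle minima
cyc : ∀ {n} → Word n → ℕ
cyc {n} v = length (filter (isCycleMin? v) (allFin n))

Tstat : ∀ {n} → Word n → ℕ
Tstat {n} v = n ∸ cyc v

Shallow : ∀ {n} → Word n → Set
Shallow v = Istat v + Tstat v ≡ Dstat v

isPerm? : ∀ {n} → Decidable (IsPerm {n})
isPerm? v = FinP.all? (λ i → FinP.all? (λ j →
  (lookup v i FinP.≟ lookup v j) →-dec (i FinP.≟ j)))

isInvolution? : ∀ {n} → Decidable (IsInvolution {n})
isInvolution? v = FinP.all? (λ i → lookup v (lookup v i) FinP.≟ i)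

avoids123? : ∀ {n} → Decidable (Avoids123 {n})
avoids123? v = FinP.all? (λ i → FinP.all? (λ j → FinP.all? (λ k →
  (toℕ i <? toℕ j) →-dec ((toℕ j <? toℕ k) →-dec
    ¬? ((val v i <? val v j) ×-dec (val v j <? val v k))))))

shallow? : ∀ {n} → Decidable (Shallow {n})
shallow? v = (Istat v + Tstat v) ≟ Dstat v

ShallowAvInv : ∀ {n} → Word n → Set
ShallowAvInv v = IsPerm v × IsInvolution v × Avoids123 v × Shallow v

shallowAvInv? : ∀ {n} → Decidable (ShallowAvInv {n})
shallowAvInv? v = isPerm? v ×-dec (isInvolution? v ×-dec (avoids123? v ×-dec shallow? v))

countShallowAvInv : ℕ → ℕ
countShallowAvInv n = length (filter shallowAvInv? (words n n))

{-# OPTIONS --safe #-}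
-- If an involution f has f 0 = 0, deleting the fixed point 0 changes none of D, I, T.  If
-- f 0 = p + 1, deleting the 2-cycle (0 p+1) lowers I + T by exactly 2(p + 1), and D by 2(p + 1)
-- plus the number of arcs of the remaining involution g that cross the deleted arc.  By
-- induction I + T ≤ D for every involution, and f is shallow iff g is shallow and no arc of g
-- crosses (0 p+1).
--
-- A 123-avoiding involution with no crossing arc decreases on both sides of the cycle through
-- 0.  So a shallow 123-avoiding involution of length M + 2 either maps 0 to M + 1 around a
-- shallow 123-avoiding involution of length M, or is one of the M + 1 involutions
-- (a−1 … 0)(M+1 … a) with 1 ≤ a ≤ M + 1; all of the latter are shallow.  Hence
-- c(M + 2) = c(M) + M + 1 with c(0) = c(1) = 1, which gives c(N) = ⌊N²/4⌋ + 1.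

module Submission where

open import Defs
open import Data.Nat using (ℕ; _≤_; _*_; _/_; _+_)
open import Relation.Binary.PropositionalEquality using (_≡_)

open import Data.Nat using (zero; suc; pred; _∸_; _<_; _<?_; _≤?_; z≤n; s≤s; s≤s⁻¹; ∣_-_∣)
open import Data.Nat.Properties
open import Data.Nat.DivMod using (+-distrib-/-∣ʳ; m*n/n≡m)
open import Data.Nat.Divisibility using (divides)
open import Data.Nat.ListAction using (sum)
open import Data.Nat.ListAction.Properties using (sum-++)
open import Data.Nat.Tactic.RingSolver using (solve-∀)
open import Algebra.Properties.CommutativeSemigroup +-commutativeSemigroup
  using (interchange; x∙yz≈y∙xz)
open import Data.Fin as Fin using (Fin; toℕ; fromℕ<)
import Data.Fin.Properties as Fin
open import Data.Vec as Vec using (Vec; lookup; tabulate)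
import Data.Vec.Properties as Vec
open import Data.List as List
  using (List; []; _∷_; _++_; map; filter; length; allFin; cartesianProduct)
import Data.List.Properties as List
open import Data.List.Membership.Propositional using (_∈_)
open import Data.List.Membership.Propositional.Properties
  using (∈-filter⁺; ∈-filter⁻; ∈-map⁺; ∈-map⁻; ∈-++⁺ˡ; ∈-++⁺ʳ; ∈-++⁻; ∈-concat⁺′; ∈-allFin)
open import Data.List.Membership.Propositional.Properties.WithK using (unique∧set⇒bag)
open import Data.List.Relation.Binary.BagAndSetEquality using (∼bag⇒↭)
open import Data.List.Relation.Binary.Disjoint.Propositional using (Disjoint)
open import Data.List.Relation.Binary.Permutation.Propositional.Properties using (↭-length)
open import Data.List.Relation.Unary.Any using (here)
import Data.List.Relation.Unary.All as All
import Data.List.Relation.Unary.All.Properties as All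
import Data.List.Relation.Unary.AllPairs as AllPairs
import Data.List.Relation.Unary.AllPairs.Properties as AllPairs
open import Data.List.Relation.Unary.Unique.Propositional using (Unique)
import Data.List.Relation.Unary.Unique.Propositional.Properties as Unique
open import Data.Product using (∃; _×_; _,_; proj₁; proj₂)
open import Data.Sum using (_⊎_; inj₁; inj₂)
open import Data.Empty using (⊥; ⊥-elim)
open import Function using (_∘_; id)
open import Function.Bundles using (_⇔_; mk⇔; Equivalence)
open import Relation.Nullary using (Dec; yes; no; ¬_)
open import Relation.Nullary.Decidable using (_×-dec_)
open import Relation.Unary using (Decidable)
open import Relation.Binary.Definitions using (tri<; tri≈; tri>)
open import Relation.Binary.PropositionalEquality
  using (refl; sym; trans; cong; cong₂; subst; subst₂; _≢_; module ≡-Reasoning)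

χ : {P : Set} → Dec P → ℕ
χ (yes _) = 1
χ (no _)  = 0

χ-yes : {P : Set} (d : Dec P) → P → χ d ≡ 1
χ-yes (yes _) _ = refl
χ-yes (no ¬p) p = ⊥-elim (¬p p)

χ-no : {P : Set} (d : Dec P) → ¬ P → χ d ≡ 0
χ-no (yes p) ¬p = ⊥-elim (¬p p)
χ-no (no _)  _  = refl

χ-cong : {P Q : Set} (d : Dec P) (e : Dec Q) → (P → Q) → (Q → P) → χ d ≡ χ e
χ-cong (yes p) e to _    = sym (χ-yes e (to p))
χ-cong (no ¬p) e _  from = sym (χ-no e (¬p ∘ from))

χ-reflects : {P Q : Set} (d : Dec P) (e : Dec Q) → χ d ≡ χ e → Q → P
χ-reflects (yes p) _       _  _ = p
χ-reflects (no _)  (yes _) () _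
χ-reflects (no _)  (no ¬q) _  q = ⊥-elim (¬q q)

∑ : ℕ → (ℕ → ℕ) → ℕ
∑ zero    g = 0
∑ (suc n) g = g 0 + ∑ n (g ∘ suc)

∑-cong : ∀ n {g h : ℕ → ℕ} → (∀ i → i < n → g i ≡ h i) → ∑ n g ≡ ∑ n h
∑-cong zero    _  = refl
∑-cong (suc n) eq = cong₂ _+_ (eq 0 (s≤s z≤n)) (∑-cong n (λ i i<n → eq (suc i) (s≤s i<n)))

∑-distrib-+ : ∀ n (g h : ℕ → ℕ) → ∑ n (λ i → g i + h i) ≡ ∑ n g + ∑ n h
∑-distrib-+ zero    g h = refl
∑-distrib-+ (suc n) g h =
  trans (cong (g 0 + h 0 +_) (∑-distrib-+ n (g ∘ suc) (h ∘ suc)))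
        (interchange (g 0) (h 0) (∑ n (g ∘ suc)) (∑ n (h ∘ suc)))

∑-zero : ∀ n {g : ℕ → ℕ} → (∀ i → i < n → g i ≡ 0) → ∑ n g ≡ 0
∑-zero zero    _  = refl
∑-zero (suc n) eq = cong₂ _+_ (eq 0 (s≤s z≤n)) (∑-zero n (λ i i<n → eq (suc i) (s≤s i<n)))

∑≡0⇒ : ∀ n (g : ℕ → ℕ) → ∑ n g ≡ 0 → ∀ i → i < n → g i ≡ 0
∑≡0⇒ (suc n) g eq zero    _         = m+n≡0⇒m≡0 (g 0) eq
∑≡0⇒ (suc n) g eq (suc i) (s≤s i<n) = ∑≡0⇒ n (g ∘ suc) (m+n≡0⇒n≡0 (g 0) eq) i i<n

∑-const-1 : ∀ n → ∑ n (λ _ → 1) ≡ n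
∑-const-1 zero    = refl
∑-const-1 (suc n) = cong suc (∑-const-1 n)

∑-χ< : ∀ n p → p ≤ n → ∑ n (λ i → χ (i <? p)) ≡ p
∑-χ< n       zero    _         = ∑-zero n (λ i _ → χ-no (i <? 0) λ ())
∑-χ< (suc n) (suc p) (s≤s p≤n) = cong suc (trans
  (∑-cong n (λ i _ → χ-cong (suc i <? suc p) (i <? p) s≤s⁻¹ s≤s))
  (∑-χ< n p p≤n))

length-filter : ∀ {A : Set} {P : A → Set} (P? : Decidable P) xs →
                length (filter P? xs) ≡ sum (map (χ ∘ P?) xs)
length-filter P? []       = refl
length-filter P? (x ∷ xs) with P? x
... | yes _ = cong suc (length-filter P? xs)
... | no  _ = length-filter P? xs

sum-allFin : ∀ n (g : Fin n → ℕ) {G : ℕ → ℕ} → (∀ i → g i ≡ G (toℕ i)) →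
             sum (map g (allFin n)) ≡ ∑ n G
sum-allFin n g eq = trans (cong sum (List.map-tabulate id g)) (sum-tabulate n g eq)
  where
  sum-tabulate : ∀ n (t : Fin n → ℕ) {G : ℕ → ℕ} → (∀ i → t i ≡ G (toℕ i)) →
                 sum (List.tabulate t) ≡ ∑ n G
  sum-tabulate zero    t eq = refl
  sum-tabulate (suc n) t eq = cong₂ _+_ (eq Fin.zero) (sum-tabulate n (t ∘ Fin.suc) (eq ∘ Fin.suc))

sum-cartesianProduct : ∀ {A B : Set} (h : A × B → ℕ) xs ys →
  sum (map h (cartesianProduct xs ys)) ≡ sum (map (λ x → sum (map (λ y → h (x , y)) ys)) xs)
sum-cartesianProduct h []       ys = refl
sum-cartesianProduct h (x ∷ xs) ys = begin
  sum (map h (map (x ,_) ys ++ cartesianProduct xs ys))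
    ≡⟨ cong sum (List.map-++ h (map (x ,_) ys) _) ⟩
  sum (map h (map (x ,_) ys) ++ map h (cartesianProduct xs ys))
    ≡⟨ sum-++ (map h (map (x ,_) ys)) _ ⟩
  sum (map h (map (x ,_) ys)) + sum (map h (cartesianProduct xs ys))
    ≡⟨ cong₂ _+_ (cong sum (sym (List.map-∘ ys))) (sum-cartesianProduct h xs ys) ⟩
  sum (map (λ y → h (x , y)) ys) + sum (map (λ x → sum (map (λ y → h (x , y)) ys)) xs)
    ∎
  where open ≡-Reasoning

punchIn : ℕ → ℕ → ℕ
punchIn zero    j       = suc j
punchIn (suc p) zero    = zero
punchIn (suc p) (suc j) = suc (punchIn p j)

punchOut : ℕ → ℕ → ℕ
punchOut zero    v       = pred v
punchOut (suc p) zero    = zero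
punchOut (suc p) (suc v) = suc (punchOut p v)

∑-punchIn : ∀ p n (h : ℕ → ℕ) → p ≤ n → ∑ (suc n) h ≡ h p + ∑ n (h ∘ punchIn p)
∑-punchIn zero    n       h _         = refl
∑-punchIn (suc p) (suc n) h (s≤s p≤n) =
  trans (cong (h 0 +_) (∑-punchIn p n (h ∘ suc) p≤n)) (x∙yz≈y∙xz (h 0) (h (suc p)) _)

punchIn-mono-< : ∀ p {a b} → a < b → punchIn p a < punchIn p b
punchIn-mono-< zero    a<b                 = s≤s a<b
punchIn-mono-< (suc p) {zero}  {suc b} _   = s≤s z≤n
punchIn-mono-< (suc p) {suc a} {suc b} a<b = s≤s (punchIn-mono-< p (s≤s⁻¹ a<b))

punchInₚ≢p : ∀ p a → punchIn p a ≢ p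
punchInₚ≢p (suc p) (suc a) eq = punchInₚ≢p p a (suc-injective eq)

punchOut-punchIn : ∀ p a → punchOut p (punchIn p a) ≡ a
punchOut-punchIn zero    a       = refl
punchOut-punchIn (suc p) zero    = refl
punchOut-punchIn (suc p) (suc a) = cong suc (punchOut-punchIn p a)

punchIn-punchOut : ∀ p v → v ≢ p → punchIn p (punchOut p v) ≡ v
punchIn-punchOut zero    zero    v≢p = ⊥-elim (v≢p refl)
punchIn-punchOut zero    (suc v) _   = refl
punchIn-punchOut (suc p) zero    _   = refl
punchIn-punchOut (suc p) (suc v) v≢p = cong suc (punchIn-punchOut p v (v≢p ∘ cong suc))

punchIn-< : ∀ p {a n} → a < n → punchIn p a < suc n
punchIn-< zero    a<n                 = s≤s a<n
punchIn-< (suc p) {zero}  _           = s≤s z≤n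
punchIn-< (suc p) {suc a} {suc n} a<n = s≤s (punchIn-< p (s≤s⁻¹ a<n))

punchOut-< : ∀ p {v n} → p ≤ n → v < suc n → v ≢ p → punchOut p v < n
punchOut-< zero    {zero}          _   _   v≢p = ⊥-elim (v≢p refl)
punchOut-< zero    {suc v}         _   v<n _   = s≤s⁻¹ v<n
punchOut-< (suc p) {zero}  {suc n} _   _   _   = s≤s z≤n
punchOut-< (suc p) {suc v} {suc n} p≤n v<n v≢p =
  s≤s (punchOut-< p (s≤s⁻¹ p≤n) (s≤s⁻¹ v<n) (v≢p ∘ cong suc))

punchIn-below : ∀ p a → a < p → punchIn p a ≡ a
punchIn-below (suc p) zero    _   = refl
punchIn-below (suc p) (suc a) a<p = cong suc (punchIn-below p a (s≤s⁻¹ a<p))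

punchIn-above : ∀ p a → p ≤ a → punchIn p a ≡ suc a
punchIn-above zero    a       _   = refl
punchIn-above (suc p) (suc a) p≤a = cong suc (punchIn-above p a (s≤s⁻¹ p≤a))

i≤punchIn : ∀ p i → i ≤ punchIn p i
i≤punchIn zero    i       = n≤1+n i
i≤punchIn (suc p) zero    = z≤n
i≤punchIn (suc p) (suc i) = s≤s (i≤punchIn p i)

∣m-1+n∣≡1+∣m-n∣ : ∀ {m n} → m ≤ n → ∣ m - suc n ∣ ≡ suc ∣ m - n ∣
∣m-1+n∣≡1+∣m-n∣ {zero}          _   = refl
∣m-1+n∣≡1+∣m-n∣ {suc m} {suc n} m≤n = ∣m-1+n∣≡1+∣m-n∣ (s≤s⁻¹ m≤n)

∣punchIn-punchIn∣ : ∀ p a b →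
  ∣ punchIn p a - punchIn p b ∣ ≡ ∣ χ (a <? p) - χ (b <? p) ∣ + ∣ a - b ∣
∣punchIn-punchIn∣ p a b with a <? p | b <? p
... | yes a<p | yes b<p = cong₂ ∣_-_∣ (punchIn-below p a a<p) (punchIn-below p b b<p)
... | no  a≮p | no  b≮p = cong₂ ∣_-_∣ (punchIn-above p a (≮⇒≥ a≮p)) (punchIn-above p b (≮⇒≥ b≮p))
... | yes a<p | no  b≮p = begin
  ∣ punchIn p a - punchIn p b ∣ ≡⟨ cong₂ ∣_-_∣ (punchIn-below p a a<p) (punchIn-above p b (≮⇒≥ b≮p)) ⟩
  ∣ a - suc b ∣                 ≡⟨ ∣m-1+n∣≡1+∣m-n∣ (<⇒≤ (<-≤-trans a<p (≮⇒≥ b≮p))) ⟩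
  suc ∣ a - b ∣                 ∎
  where open ≡-Reasoning
... | no  a≮p | yes b<p = begin
  ∣ punchIn p a - punchIn p b ∣ ≡⟨ cong₂ ∣_-_∣ (punchIn-above p a (≮⇒≥ a≮p)) (punchIn-below p b b<p) ⟩
  ∣ suc a - b ∣                 ≡⟨ ∣-∣-comm (suc a) b ⟩
  ∣ b - suc a ∣                 ≡⟨ ∣m-1+n∣≡1+∣m-n∣ (<⇒≤ (<-≤-trans b<p (≮⇒≥ a≮p))) ⟩
  suc ∣ b - a ∣                 ≡⟨ cong suc (∣-∣-comm b a) ⟩
  suc ∣ a - b ∣                 ∎
  where open ≡-Reasoning

-- Involutions of {0, …, N−1} as functions on ℕ

Bounded : ℕ → (ℕ → ℕ) → Set
Bounded N f = ∀ i → i < N → f i < N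

Involution : ℕ → (ℕ → ℕ) → Set
Involution N f = Bounded N f × (∀ i → i < N → f (f i) ≡ i)

Avoids : ℕ → (ℕ → ℕ) → Set
Avoids N f = ∀ i j k → i < j → j < k → k < N → f i < f j → f j < f k → ⊥

IsInversion : (ℕ → ℕ) → ℕ → ℕ → Set
IsInversion f i j = i < j × f j < f i

inversion? : ∀ f i j → Dec (IsInversion f i j)
inversion? f i j = (i <? j) ×-dec (f j <? f i)

-- T counts the i with f i < i; for an involution that is the number of 2-cycles, N − cyc(f).
D I T : ℕ → (ℕ → ℕ) → ℕ
D N f = ∑ N (λ i → ∣ f i - i ∣)
I N f = ∑ N (λ i → ∑ N (λ j → χ (inversion? f i j)))
T N f = ∑ N (λ i → χ (f i <? i))

IsShallow : ℕ → (ℕ → ℕ) → Set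
IsShallow N f = I N f + T N f ≡ D N f

ShallowAvInvOn : ℕ → (ℕ → ℕ) → Set
ShallowAvInvOn N f = Involution N f × Avoids N f × IsShallow N f

zero-or-suc : ∀ n → n ≡ 0 ⊎ ∃ λ p → n ≡ suc p
zero-or-suc zero    = inj₁ refl
zero-or-suc (suc p) = inj₂ (p , refl)

involution₁-fixes-0 : ∀ {f p} → Involution 1 f → f 0 ≢ suc p
involution₁-fixes-0 inv f0 = n≮0 (s≤s⁻¹ (subst (_< 1) f0 (proj₁ inv 0 (s≤s z≤n))))

involution-injective : ∀ {N f} → Involution N f → ∀ {i j} → i < N → j < N → f i ≡ f j → i ≡ j
involution-injective {f = f} (_ , invol) {i} {j} i<N j<N eq =
  trans (sym (invol i i<N)) (trans (cong f eq) (invol j j<N))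

module Conjugate {N : ℕ} {f g σ : ℕ → ℕ}
  (σ-mono : ∀ {a b} → a < b → σ a < σ b) (conj : ∀ i → i < N → f (σ i) ≡ σ (g i)) where

  σ-cancel : ∀ {a b} → σ a < σ b → a < b
  σ-cancel {a} {b} σa<σb with <-cmp a b
  ... | tri< a<b _ _ = a<b
  ... | tri≈ _ refl _ = ⊥-elim (<-irrefl refl σa<σb)
  ... | tri> _ _ b<a = ⊥-elim (<-asym σa<σb (σ-mono b<a))

  f-σ-< : ∀ {i j} → i < N → j < N → f (σ i) < f (σ j) → g i < g j
  f-σ-< i<N j<N lt = σ-cancel (subst₂ _<_ (conj _ i<N) (conj _ j<N) lt)

  g-< : ∀ {i j} → i < N → j < N → g i < g j → f (σ i) < f (σ j)
  g-< i<N j<N lt = subst₂ _<_ (sym (conj _ i<N)) (sym (conj _ j<N)) (σ-mono lt)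

  χ-inversion : ∀ {i j} → i < N → j < N → χ (inversion? f (σ i) (σ j)) ≡ χ (inversion? g i j)
  χ-inversion i<N j<N = χ-cong (inversion? f _ _) (inversion? g _ _)
    (λ (lt , inv) → σ-cancel lt , f-σ-< j<N i<N inv)
    (λ (lt , inv) → σ-mono lt , g-< j<N i<N inv)

  χ-descent : ∀ {i} → i < N → χ (f (σ i) <? σ i) ≡ χ (g i <? i)
  χ-descent {i} i<N = χ-cong (f (σ i) <? σ i) (g i <? i)
    (λ lt → σ-cancel (subst (_< σ i) (conj i i<N) lt))
    (λ lt → subst (_< σ i) (sym (conj i i<N)) (σ-mono lt))

  restriction-avoids : ∀ {M} → (∀ i → i < N → σ i < M) → Avoids M f → Avoids N g
  restriction-avoids σ<M av i j k i<j j<k k<N gi<gj gj<gk =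
    av (σ i) (σ j) (σ k) (σ-mono i<j) (σ-mono j<k) (σ<M k k<N)
      (g-< i<N j<N gi<gj) (g-< j<N k<N gj<gk)
    where
    j<N : j < N
    j<N = <-trans j<k k<N
    i<N : i < N
    i<N = <-trans i<j j<N

-- Deleting the cycle through 0

-- Remove the fixed point 0, resp. the 2-cycle (0 p+1), and renumber the other points in order.
delete₁ : (ℕ → ℕ) → ℕ → ℕ
delete₁ f i = pred (f (suc i))

module Delete₁ {N : ℕ} {f : ℕ → ℕ} (inv : Involution (suc N) f) (f0 : f 0 ≡ 0) where

  f-suc : ∀ i → i < N → f (suc i) ≡ suc (delete₁ f i)
  f-suc i i<N with f (suc i) in eq
  ... | zero  = ⊥-elim (1+n≢0 (involution-injective inv (s≤s i<N) (s≤s z≤n) (trans eq (sym f0))))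
  ... | suc _ = refl

  involution : Involution N (delete₁ f)
  involution =
    (λ i i<N → s≤s⁻¹ (subst (_< suc N) (f-suc i i<N) (proj₁ inv (suc i) (s≤s i<N)))) ,
    (λ i i<N → cong pred (trans (cong f (sym (f-suc i i<N))) (proj₂ inv (suc i) (s≤s i<N))))

  open Conjugate {f = f} {σ = suc} s≤s f-suc

  D-eq : D (suc N) f ≡ D N (delete₁ f)
  D-eq = cong₂ _+_ (cong (λ v → ∣ v - 0 ∣) f0)
                   (∑-cong N (λ i i<N → cong (λ v → ∣ v - suc i ∣) (f-suc i i<N)))

  T-eq : T (suc N) f ≡ T N (delete₁ f)
  T-eq = cong₂ _+_ (χ-no (f 0 <? 0) n≮0) (∑-cong N (λ i i<N → χ-descent i<N))

  I-eq : I (suc N) f ≡ I N (delete₁ f)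
  I-eq = cong₂ _+_
    (∑-zero (suc N) (λ j _ → χ-no (inversion? f 0 j) (λ (_ , lt) → n≮0 (subst (f j <_) f0 lt))))
    (∑-cong N (λ i i<N → cong₂ _+_
      (χ-no (inversion? f (suc i) 0) (λ (lt , _) → n≮0 lt))
      (∑-cong N (λ j j<N → χ-inversion i<N j<N))))

delete₂ : ℕ → (ℕ → ℕ) → ℕ → ℕ
delete₂ p f i = punchOut p (pred (f (suc (punchIn p i))))

NoCrossing : ℕ → ℕ → (ℕ → ℕ) → Set
NoCrossing N p g = ∀ i → i < N → (g i < p → i < p) × (i < p → g i < p)

module Delete₂ {N p : ℕ} {f : ℕ → ℕ} (inv : Involution (suc (suc N)) f) (f0 : f 0 ≡ suc p) where

  p≤N : p ≤ N
  p≤N = s≤s⁻¹ (s≤s⁻¹ (subst (_< suc (suc N)) f0 (proj₁ inv 0 (s≤s z≤n))))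

  f-suc-p : f (suc p) ≡ 0
  f-suc-p = trans (cong f (sym f0)) (proj₂ inv 0 (s≤s z≤n))

  σ : ℕ → ℕ
  σ i = suc (punchIn p i)

  σ-mono : ∀ {a b} → a < b → σ a < σ b
  σ-mono a<b = s≤s (punchIn-mono-< p a<b)

  σ< : ∀ {i} → i < N → σ i < suc (suc N)
  σ< i<N = s≤s (punchIn-< p i<N)

  ∑-split : ∀ h → ∑ (suc (suc N)) h ≡ h 0 + (h (suc p) + ∑ N (h ∘ σ))
  ∑-split h = cong (h 0 +_) (∑-punchIn p N (h ∘ suc) p≤N)

  f-σ : ∀ i → i < N → f (σ i) ≡ σ (delete₂ p f i)
  f-σ i i<N with f (σ i) in eq
  ... | zero  = ⊥-elim (punchInₚ≢p p i (suc-injective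
                  (trans (sym (proj₂ inv _ (σ< i<N))) (trans (cong f eq) f0))))
  ... | suc w = cong suc (sym (punchIn-punchOut p w w≢p))
    where
    w≢p : w ≢ p
    w≢p refl = 1+n≢0 (trans (sym (proj₂ inv _ (σ< i<N))) (trans (cong f eq) f-suc-p))

  involution : Involution N (delete₂ p f)
  involution = bounded , involutive
    where
    bounded : Bounded N (delete₂ p f)
    bounded i i<N = punchOut-< p p≤N w<1+N (punchInₚ≢p p _ ∘ trans (sym w≡))
      where
      w≡ : pred (f (σ i)) ≡ punchIn p (delete₂ p f i)
      w≡ = cong pred (f-σ i i<N)
      w<1+N : pred (f (σ i)) < suc N
      w<1+N = subst (_< suc N) (sym w≡)
                (s≤s⁻¹ (subst (_< suc (suc N)) (f-σ i i<N) (proj₁ inv _ (σ< i<N))))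
    involutive : ∀ i → i < N → delete₂ p f (delete₂ p f i) ≡ i
    involutive i i<N = begin
      punchOut p (pred (f (σ (delete₂ p f i)))) ≡⟨ cong (punchOut p ∘ pred ∘ f) (sym (f-σ i i<N)) ⟩
      punchOut p (pred (f (f (σ i))))          ≡⟨ cong (punchOut p ∘ pred) (proj₂ inv _ (σ< i<N)) ⟩
      punchOut p (punchIn p i)                 ≡⟨ punchOut-punchIn p i ⟩
      i                                        ∎
      where open ≡-Reasoning

  open Conjugate {f = f} {σ = σ} σ-mono f-σ

  -- the arcs of delete₂ p f that cross the deleted arc (0 p+1)
  crossings : ℕ
  crossings = ∑ N (λ i → ∣ χ (delete₂ p f i <? p) - χ (i <? p) ∣)

  D-eq : D (suc (suc N)) f ≡ suc p + (suc p + (crossings + D N (delete₂ p f)))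
  D-eq = begin
    D (suc (suc N)) f
      ≡⟨ ∑-split (λ i → ∣ f i - i ∣) ⟩
    ∣ f 0 - 0 ∣ + (∣ f (suc p) - suc p ∣ + ∑ N (λ i → ∣ f (σ i) - σ i ∣))
      ≡⟨ cong₂ _+_ (cong (λ v → ∣ v - 0 ∣) f0) (cong₂ _+_ (cong (λ v → ∣ v - suc p ∣) f-suc-p)
           (∑-cong N (λ i i<N → trans (cong (λ v → ∣ v - σ i ∣) (f-σ i i<N))
                                       (∣punchIn-punchIn∣ p (delete₂ p f i) i)))) ⟩
    suc p + (suc p + ∑ N (λ i → ∣ χ (delete₂ p f i <? p) - χ (i <? p) ∣ + ∣ delete₂ p f i - i ∣))
      ≡⟨ cong (λ s → suc p + (suc p + s)) (∑-distrib-+ N _ _) ⟩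
    suc p + (suc p + (crossings + D N (delete₂ p f)))
      ∎
    where open ≡-Reasoning

  T-eq : T (suc (suc N)) f ≡ suc (T N (delete₂ p f))
  T-eq = trans (∑-split (λ i → χ (f i <? i))) (cong₂ _+_ (χ-no (f 0 <? 0) n≮0)
    (cong₂ _+_ (χ-yes (f (suc p) <? suc p) (subst (_< suc p) (sym f-suc-p) (s≤s z≤n)))
               (∑-cong N (λ i i<N → χ-descent i<N))))

  crossings≡0⇒ : crossings ≡ 0 → NoCrossing N p (delete₂ p f)
  crossings≡0⇒ c≡0 i i<N = χ-reflects (i <? p) (delete₂ p f i <? p) (sym χ≡) ,
                           χ-reflects (delete₂ p f i <? p) (i <? p) χ≡
    where
    χ≡ : χ (delete₂ p f i <? p) ≡ χ (i <? p)
    χ≡ = ∣m-n∣≡0⇒m≡n (∑≡0⇒ N _ c≡0 i i<N)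

  NoCrossing⇒crossings≡0 : NoCrossing N p (delete₂ p f) → crossings ≡ 0
  NoCrossing⇒crossings≡0 nc = ∑-zero N (λ i i<N →
    trans (cong (λ c → ∣ c - χ (i <? p) ∣)
                (χ-cong (delete₂ p f i <? p) (i <? p) (proj₁ (nc i i<N)) (proj₂ (nc i i<N))))
          (∣n-n∣≡0 (χ (i <? p))))

  avoids : Avoids (suc (suc N)) f → Avoids N (delete₂ p f)
  avoids = restriction-avoids (λ _ → σ<)

  noCrossing-outer : NoCrossing N p (delete₂ p f) → ∀ x → suc p < x → x < suc (suc N) → suc p < f x
  noCrossing-outer nc (suc (suc i)) (s≤s (s≤s p≤i)) (s≤s (s≤s i<N)) = begin-strict
    suc p                         <⟨ s≤s (s≤s p≤g) ⟩
    suc (suc (delete₂ p f i))     ≡⟨ cong suc (punchIn-above p _ p≤g) ⟨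
    σ (delete₂ p f i)             ≡⟨ f-σ i i<N ⟨
    f (σ i)                       ≡⟨ cong (f ∘ suc) (punchIn-above p i p≤i) ⟩
    f (suc (suc i))               ∎
    where
    open ≤-Reasoning
    p≤g : p ≤ delete₂ p f i
    p≤g = ≮⇒≥ (λ g<p → <⇒≱ (proj₁ (nc i i<N) g<p) p≤i)

  noCrossing-inner : NoCrossing N p (delete₂ p f) → ∀ x → 0 < x → x < suc p → f x < suc p
  noCrossing-inner nc (suc i) _ (s≤s i<p) = begin-strict
    f (suc i)                     ≡⟨ cong (f ∘ suc) (punchIn-below p i i<p) ⟨
    f (σ i)                       ≡⟨ f-σ i i<N ⟩
    σ (delete₂ p f i)             ≡⟨ cong suc (punchIn-below p _ g<p) ⟩
    suc (delete₂ p f i)           <⟨ s≤s g<p ⟩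
    suc p                         ∎
    where
    open ≤-Reasoning
    i<N : i < N
    i<N = <-≤-trans i<p p≤N
    g<p : delete₂ p f i < p
    g<p = proj₂ (nc i i<N) i<p

-- The inequality I + T ≤ D and its equality case

∑-involution : ∀ N {f} (h : ℕ → ℕ) → Involution N f → ∑ N (h ∘ f) ≡ ∑ N h
∑-involution zero h inv = refl
∑-involution (suc N) {f} h inv with zero-or-suc (f 0)
... | inj₁ f0 = cong₂ _+_ (cong h f0) (trans (∑-cong N (λ i i<N → cong h (f-suc i i<N)))
                                             (∑-involution N (h ∘ suc) involution))
  where open Delete₁ inv f0
∑-involution (suc zero) h inv | inj₂ (p , f0) =
  ⊥-elim (involution₁-fixes-0 inv f0)
∑-involution (suc (suc N)) {f} h inv | inj₂ (p , f0) = begin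
  ∑ (suc (suc N)) (h ∘ f)
    ≡⟨ ∑-split (h ∘ f) ⟩
  h (f 0) + (h (f (suc p)) + ∑ N (h ∘ f ∘ σ))
    ≡⟨ cong₂ _+_ (cong h f0) (cong₂ _+_ (cong h f-suc-p) (∑-cong N (λ i i<N → cong h (f-σ i i<N)))) ⟩
  h (suc p) + (h 0 + ∑ N (h ∘ σ ∘ delete₂ p f))
    ≡⟨ cong (λ s → h (suc p) + (h 0 + s)) (∑-involution N (h ∘ σ) involution) ⟩
  h (suc p) + (h 0 + ∑ N (h ∘ σ))
    ≡⟨ x∙yz≈y∙xz (h (suc p)) (h 0) _ ⟩
  h 0 + (h (suc p) + ∑ N (h ∘ σ))
    ≡⟨ ∑-split h ⟨
  ∑ (suc (suc N)) h
    ∎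
  where open ≡-Reasoning
        open Delete₂ inv f0

inversions-at-0 : ∀ {N p f} → Involution N f → f 0 ≡ suc p → suc p ≤ N →
                  ∑ N (λ j → χ (inversion? f 0 j)) ≡ suc p
inversions-at-0 {N} {p} {f} inv f0 1+p≤N = begin
  ∑ N (λ j → χ (inversion? f 0 j))
    ≡⟨ ∑-cong N (λ j _ → χ-cong (inversion? f 0 j) (f j <? suc p)
         (λ (_ , lt) → subst (f j <_) f0 lt)
         (λ lt → 0<j j lt , subst (f j <_) (sym f0) lt)) ⟩
  ∑ N (λ j → χ (f j <? suc p))
    ≡⟨ ∑-involution N (λ v → χ (v <? suc p)) inv ⟩
  ∑ N (λ j → χ (j <? suc p))
    ≡⟨ ∑-χ< N (suc p) 1+p≤N ⟩
  suc p
    ∎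
  where
  open ≡-Reasoning
  0<j : ∀ j → f j < suc p → 0 < j
  0<j zero    lt = ⊥-elim (<-irrefl f0 lt)
  0<j (suc j) _  = s≤s z≤n

I-delete₂ : ∀ {N p f} (inv : Involution (suc (suc N)) f) (f0 : f 0 ≡ suc p) →
            I (suc (suc N)) f ≡ suc p + (p + I N (delete₂ p f))
I-delete₂ {N} {p} {f} inv f0 = begin
  I (suc (suc N)) f
    ≡⟨ ∑-split row ⟩
  row 0 + (row (suc p) + ∑ N (row ∘ σ))
    ≡⟨ cong₂ _+_ (inversions-at-0 inv f0 (s≤s (m≤n⇒m≤1+n p≤N)))
                 (cong₂ _+_ row-suc-p (∑-cong N row-σ)) ⟩
  suc p + ∑ N (λ i → χ (i <? p) + ∑ N (λ j → χ (inversion? g i j)))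
    ≡⟨ cong (suc p +_) (trans (∑-distrib-+ N _ _) (cong (_+ I N g) (∑-χ< N p p≤N))) ⟩
  suc p + (p + I N g)
    ∎
  where
  open ≡-Reasoning
  open Delete₂ inv f0
  open Conjugate {f = f} {σ = σ} σ-mono f-σ
  g : ℕ → ℕ
  g = delete₂ p f
  row : ℕ → ℕ
  row i = ∑ (suc (suc N)) (λ j → χ (inversion? f i j))

  row-suc-p : row (suc p) ≡ 0
  row-suc-p = ∑-zero (suc (suc N)) (λ j _ → χ-no (inversion? f (suc p) j)
    (λ (_ , lt) → n≮0 (subst (f j <_) f-suc-p lt)))

  row-σ : ∀ i → i < N → row (σ i) ≡ χ (i <? p) + ∑ N (λ j → χ (inversion? g i j))
  row-σ i i<N = trans (∑-split (λ j → χ (inversion? f (σ i) j))) (cong₂ _+_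
    (χ-no (inversion? f (σ i) 0) (λ (lt , _) → n≮0 lt))
    (cong₂ _+_
      (χ-cong (inversion? f (σ i) (suc p)) (i <? p)
        (λ (lt , _) → ≤-<-trans (i≤punchIn p i) (s≤s⁻¹ lt))
        (λ i<p → s≤s (subst (_< p) (sym (punchIn-below p i i<p)) i<p) ,
                 subst₂ _<_ (sym f-suc-p) (sym (f-σ i i<N)) (s≤s z≤n)))
      (∑-cong N (λ j j<N → χ-inversion i<N j<N))))

I+T-delete₂ : ∀ {N p f} (inv : Involution (suc (suc N)) f) (f0 : f 0 ≡ suc p) →
              I (suc (suc N)) f + T (suc (suc N)) f ≡
              suc p + (suc p + (I N (delete₂ p f) + T N (delete₂ p f)))
I+T-delete₂ {N} {p} {f} inv f0 =
  trans (cong₂ _+_ (I-delete₂ inv f0) T-eq) (regroup p (I N (delete₂ p f)) (T N (delete₂ p f)))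
  where
  open Delete₂ inv f0
  regroup : ∀ p a b → suc p + (p + a) + suc b ≡ suc p + (suc p + (a + b))
  regroup = solve-∀

I+T≤D : ∀ N {f} → Involution N f → I N f + T N f ≤ D N f
I+T≤D zero _ = z≤n
I+T≤D (suc N) {f} inv with zero-or-suc (f 0)
... | inj₁ f0 = subst₂ _≤_ (sym (cong₂ _+_ I-eq T-eq)) (sym D-eq) (I+T≤D N involution)
  where open Delete₁ inv f0
I+T≤D (suc zero) inv | inj₂ (p , f0) = ⊥-elim (involution₁-fixes-0 inv f0)
I+T≤D (suc (suc N)) {f} inv | inj₂ (p , f0) = begin
  I (suc (suc N)) f + T (suc (suc N)) f
    ≡⟨ I+T-delete₂ inv f0 ⟩
  suc p + (suc p + (I N (delete₂ p f) + T N (delete₂ p f)))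
    ≤⟨ +-monoʳ-≤ (suc p) (+-monoʳ-≤ (suc p) (≤-trans (I+T≤D N involution) (m≤n+m _ crossings))) ⟩
  suc p + (suc p + (crossings + D N (delete₂ p f)))
    ≡⟨ D-eq ⟨
  D (suc (suc N)) f
    ∎
  where open ≤-Reasoning
        open Delete₂ inv f0

shallow-delete₂⇔ : ∀ {N p f} (inv : Involution (suc (suc N)) f) (f0 : f 0 ≡ suc p) →
  IsShallow (suc (suc N)) f ⇔ (NoCrossing N p (delete₂ p f) × IsShallow N (delete₂ p f))
shallow-delete₂⇔ {N} {p} {f} inv f0 = mk⇔ to from
  where
  open Delete₂ inv f0
  g : ℕ → ℕ
  g = delete₂ p f

  to : IsShallow (suc (suc N)) f → NoCrossing N p g × IsShallow N g
  to sh = crossings≡0⇒ c≡0 , trans I+T≡ (cong (_+ D N g) c≡0)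
    where
    I+T≡ : I N g + T N g ≡ crossings + D N g
    I+T≡ = +-cancelˡ-≡ (suc p) _ _ (+-cancelˡ-≡ (suc p) _ _
             (trans (sym (I+T-delete₂ inv f0)) (trans sh D-eq)))
    c≡0 : crossings ≡ 0
    c≡0 = n≤0⇒n≡0 (+-cancelʳ-≤ (D N g) crossings 0
            (≤-trans (≤-reflexive (sym I+T≡)) (I+T≤D N involution)))

  from : NoCrossing N p g × IsShallow N g → IsShallow (suc (suc N)) f
  from (nc , sh) = begin
    I (suc (suc N)) f + T (suc (suc N)) f  ≡⟨ I+T-delete₂ inv f0 ⟩
    suc p + (suc p + (I N g + T N g))      ≡⟨ cong (λ s → suc p + (suc p + s)) sh ⟩
    suc p + (suc p + D N g)                ≡⟨ cong (λ c → suc p + (suc p + (c + D N g)))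
                                                   (NoCrossing⇒crossings≡0 nc) ⟨
    suc p + (suc p + (crossings + D N g))  ≡⟨ D-eq ⟨
    D (suc (suc N)) f                      ∎
    where open ≡-Reasoning

_≈[_]_ : (ℕ → ℕ) → ℕ → (ℕ → ℕ) → Set
f ≈[ N ] g = ∀ i → i < N → f i ≡ g i

module _ (N : ℕ) {f g : ℕ → ℕ} (f≈g : f ≈[ N ] g) where
  open Conjugate {f = f} {g = g} {σ = id} id f≈g

  Involution-cong : Involution N f → Involution N g
  Involution-cong (bnd , invol) = bnd′ , invol′
    where
    bnd′ : Bounded N g
    bnd′ i i<N = subst (_< N) (f≈g i i<N) (bnd i i<N)
    invol′ : ∀ i → i < N → g (g i) ≡ i
    invol′ i i<N = trans (sym (f≈g _ (bnd′ i i<N))) (trans (cong f (sym (f≈g i i<N))) (invol i i<N))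

  IsShallow-cong : IsShallow N f → IsShallow N g
  IsShallow-cong sh = trans (cong₂ _+_ I≡ T≡) (trans sh D≡)
    where
    I≡ : I N g ≡ I N f
    I≡ = ∑-cong N (λ i i<N → ∑-cong N (λ j j<N → sym (χ-inversion i<N j<N)))
    T≡ : T N g ≡ T N f
    T≡ = ∑-cong N (λ i i<N → sym (χ-descent i<N))
    D≡ : D N f ≡ D N g
    D≡ = ∑-cong N (λ i i<N → cong (λ v → ∣ v - i ∣) (f≈g i i<N))

  ShallowAvInvOn-cong : ShallowAvInvOn N f → ShallowAvInvOn N g
  ShallowAvInvOn-cong (inv , av , sh) =
    Involution-cong inv , restriction-avoids (λ _ i<N → i<N) av , IsShallow-cong sh

delete₁-conj : ∀ N {f h} → (∀ i → i < N → f (suc i) ≡ suc (h i)) → delete₁ f ≈[ N ] h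
delete₁-conj N conj i i<N = cong pred (conj i i<N)

delete₂-conj : ∀ N p {f h} → (∀ i → i < N → f (suc (punchIn p i)) ≡ suc (punchIn p (h i))) →
               delete₂ p f ≈[ N ] h
delete₂-conj N p conj i i<N = trans (cong (punchOut p ∘ pred) (conj i i<N)) (punchOut-punchIn p _)

NoCrossing-top : ∀ {N g} → Bounded N g → NoCrossing N N g
NoCrossing-top bnd i i<N = (λ _ → i<N) , (λ _ → bnd i i<N)

shallow-insert₁ : ∀ {N f h} → Involution (suc N) f → f 0 ≡ 0 →
  (∀ i → i < N → f (suc i) ≡ suc (h i)) → IsShallow N h → IsShallow (suc N) f
shallow-insert₁ {N} {f} inv f0 conj sh = trans (cong₂ _+_ I-eq T-eq) (trans sh′ (sym D-eq))
  where
  open Delete₁ inv f0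
  sh′ : IsShallow N (delete₁ f)
  sh′ = IsShallow-cong N (λ i i<N → sym (delete₁-conj N {f = f} conj i i<N)) sh

shallow-insert₂ : ∀ {N p f h} → Involution (suc (suc N)) f → f 0 ≡ suc p →
  (∀ i → i < N → f (suc (punchIn p i)) ≡ suc (punchIn p (h i))) →
  NoCrossing N p h → IsShallow N h → IsShallow (suc (suc N)) f
shallow-insert₂ {N} {p} {f} inv f0 conj nc sh = Equivalence.from (shallow-delete₂⇔ inv f0)
  ((λ i i<N → subst (λ v → (v < p → i < p) × (i < p → v < p)) (sym (h≈ i i<N)) (nc i i<N)) ,
   IsShallow-cong N (λ i i<N → sym (h≈ i i<N)) sh)
  where
  h≈ : delete₂ p f ≈[ N ] _
  h≈ = delete₂-conj N p {f = f} conj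

-- Wrapping and two-run involutions

-- (M+1) (g 0 + 1) … (g (M−1) + 1) 0 in one-line notation: g nested inside the arc (0 M+1).
wrap : ℕ → (ℕ → ℕ) → ℕ → ℕ
wrap M g zero = suc M
wrap M g (suc j) with j <? M
... | yes _ = suc (g j)
... | no  _ = 0

wrap-suc : ∀ M g {j} → j < M → wrap M g (suc j) ≡ suc (g j)
wrap-suc M g {j} j<M with j <? M
... | yes _   = refl
... | no  j≮M = ⊥-elim (j≮M j<M)

wrap-last : ∀ M g → wrap M g (suc M) ≡ 0
wrap-last M g with M <? M
... | yes M<M = ⊥-elim (<-irrefl refl M<M)
... | no  _   = refl

wrap-conj : ∀ M {g} → Bounded M g → ∀ i → i < M → wrap M g (suc (punchIn M i)) ≡ suc (punchIn M (g i))
wrap-conj M {g} bnd i i<M = begin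
  wrap M g (suc (punchIn M i)) ≡⟨ cong (wrap M g ∘ suc) (punchIn-below M i i<M) ⟩
  wrap M g (suc i)             ≡⟨ wrap-suc M g i<M ⟩
  suc (g i)                    ≡⟨ cong suc (punchIn-below M (g i) (bnd i i<M)) ⟨
  suc (punchIn M (g i))        ∎
  where open ≡-Reasoning

wrap-bounded : ∀ M {g} → Bounded M g → Bounded (suc (suc M)) (wrap M g)
wrap-bounded M {g} bnd zero    _ = ≤-refl
wrap-bounded M {g} bnd (suc j) j<2+M with m<1+n⇒m<n∨m≡n (s≤s⁻¹ j<2+M)
... | inj₁ j<M  = subst (_< suc (suc M)) (sym (wrap-suc M g j<M)) (s≤s (m<n⇒m<1+n (bnd j j<M)))
... | inj₂ refl = subst (_< suc (suc M)) (sym (wrap-last M g)) (s≤s z≤n)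

wrap-involution : ∀ M {g} → Involution M g → Involution (suc (suc M)) (wrap M g)
wrap-involution M {g} (bnd , invol) = wrap-bounded M bnd , invol′
  where
  invol′ : ∀ i → i < suc (suc M) → wrap M g (wrap M g i) ≡ i
  invol′ zero    _       = wrap-last M g
  invol′ (suc j) j<2+M with m<1+n⇒m<n∨m≡n (s≤s⁻¹ j<2+M)
  ... | inj₁ j<M  = trans (cong (wrap M g) (wrap-suc M g j<M))
                          (trans (wrap-suc M g (bnd j j<M)) (cong suc (invol j j<M)))
  ... | inj₂ refl = cong (wrap M g) (wrap-last M g)

wrap-avoids : ∀ M {g} → Bounded M g → Avoids M g → Avoids (suc (suc M)) (wrap M g)
wrap-avoids M {g} bnd av zero j k _ j<k k<2+M w0<wj _ =
  <-irrefl refl (<-≤-trans (wrap-bounded M bnd j (<-trans j<k k<2+M)) w0<wj)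
wrap-avoids M {g} bnd av (suc i) (suc j) (suc k) i<j j<k k<2+M wi<wj wj<wk
  with m<1+n⇒m<n∨m≡n (s≤s⁻¹ k<2+M)
... | inj₂ refl = n≮0 (subst (wrap M g (suc j) <_) (wrap-last M g) wj<wk)
... | inj₁ k<M  = av i j k (s≤s⁻¹ i<j) (s≤s⁻¹ j<k) k<M
                    (s≤s⁻¹ (subst₂ _<_ (wrap-suc M g i<M) (wrap-suc M g j<M) wi<wj))
                    (s≤s⁻¹ (subst₂ _<_ (wrap-suc M g j<M) (wrap-suc M g k<M) wj<wk))
  where
  j<M : j < M
  j<M = <-trans (s≤s⁻¹ j<k) k<M
  i<M : i < M
  i<M = <-trans (s≤s⁻¹ i<j) j<M

wrap-cong : ∀ M {g h} → g ≈[ M ] h → wrap M g ≈[ suc (suc M) ] wrap M h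
wrap-cong M g≈h zero    _ = refl
wrap-cong M {g} {h} g≈h (suc j) j<2+M with m<1+n⇒m<n∨m≡n (s≤s⁻¹ j<2+M)
... | inj₁ j<M  = trans (wrap-suc M g j<M) (trans (cong suc (g≈h j j<M)) (sym (wrap-suc M h j<M)))
... | inj₂ refl = trans (wrap-last M g) (sym (wrap-last M h))

wrap-shallowAvInv : ∀ M {g} → ShallowAvInvOn M g → ShallowAvInvOn (suc (suc M)) (wrap M g)
wrap-shallowAvInv M {g} ((bnd , invol) , av , sh) =
  inv , wrap-avoids M bnd av , shallow-insert₂ inv refl (wrap-conj M bnd) (NoCrossing-top bnd) sh
  where
  inv : Involution (suc (suc M)) (wrap M g)
  inv = wrap-involution M (bnd , invol)

wrap-delete₂ : ∀ M {f} → Involution (suc (suc M)) f → f 0 ≡ suc M →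
               wrap M (delete₂ M f) ≈[ suc (suc M) ] f
wrap-delete₂ M     inv f0 zero    _ = sym f0
wrap-delete₂ M {f} inv f0 (suc j) j<2+M with m<1+n⇒m<n∨m≡n (s≤s⁻¹ j<2+M)
... | inj₂ refl = trans (wrap-last M (delete₂ M f)) (sym f-suc-p)
  where open Delete₂ inv f0
... | inj₁ j<M  = begin
  wrap M (delete₂ M f) (suc j)        ≡⟨ wrap-suc M _ j<M ⟩
  suc (delete₂ M f j)                 ≡⟨ cong suc (punchIn-below M _ (proj₁ involution j j<M)) ⟨
  suc (punchIn M (delete₂ M f j))     ≡⟨ f-σ j j<M ⟨
  f (suc (punchIn M j))               ≡⟨ cong (f ∘ suc) (punchIn-below M j j<M) ⟩
  f (suc j)                           ∎
  where open ≡-Reasoning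
        open Delete₂ inv f0

-- (a−1 … 1 0) (N−1 … a+1 a) in one-line notation: two decreasing runs.
blocks : ℕ → ℕ → ℕ → ℕ
blocks N a x with x <? a
... | yes _ = a ∸ suc x
... | no  _ = N + a ∸ suc x

blocks-below : ∀ N {a x} → x < a → blocks N a x + suc x ≡ a
blocks-below N {a} {x} x<a with x <? a
... | yes _   = m∸n+n≡m x<a
... | no  x≮a = ⊥-elim (x≮a x<a)

blocks-above : ∀ N {a x} → a ≤ x → x < N → blocks N a x + suc x ≡ N + a
blocks-above N {a} {x} a≤x x<N with x <? a
... | yes x<a = ⊥-elim (<-irrefl refl (<-≤-trans x<a a≤x))
... | no  _   = m∸n+n≡m (≤-trans x<N (m≤m+n N a))

blocks-below-unique : ∀ N {a x y} → x < a → y + suc x ≡ a → blocks N a x ≡ y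
blocks-below-unique N x<a eq = +-cancelʳ-≡ _ _ _ (trans (blocks-below N x<a) (sym eq))

blocks-above-unique : ∀ N {a x y} → a ≤ x → x < N → y + suc x ≡ N + a → blocks N a x ≡ y
blocks-above-unique N a≤x x<N eq = +-cancelʳ-≡ _ _ _ (trans (blocks-above N a≤x x<N) (sym eq))

blocks-below-< : ∀ N {a x} → x < a → blocks N a x < a
blocks-below-< N {a} {x} x<a = subst (blocks N a x <_) (blocks-below N x<a) (m<m+n _ (s≤s z≤n))

blocks-above-≥ : ∀ N {a x} → a ≤ x → x < N → a ≤ blocks N a x
blocks-above-≥ N {a} {x} a≤x x<N = +-cancelˡ-≤ N a (blocks N a x) (begin
  N + a               ≡⟨ blocks-above N a≤x x<N ⟨
  blocks N a x + suc x ≤⟨ +-monoʳ-≤ (blocks N a x) x<N ⟩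
  blocks N a x + N     ≡⟨ +-comm (blocks N a x) N ⟩
  N + blocks N a x     ∎)
  where open ≤-Reasoning

blocks-above-< : ∀ N {a x} → a ≤ x → x < N → blocks N a x < N
blocks-above-< N {a} {x} a≤x x<N = +-cancelʳ-≤ x (suc (blocks N a x)) N (begin
  suc (blocks N a x) + x ≡⟨ +-suc (blocks N a x) x ⟨
  blocks N a x + suc x   ≡⟨ blocks-above N a≤x x<N ⟩
  N + a                  ≤⟨ +-monoʳ-≤ N a≤x ⟩
  N + x                  ∎)
  where open ≤-Reasoning

blocks-involution : ∀ N {a} → a ≤ N → Involution N (blocks N a)
blocks-involution N {a} a≤N = bnd , invol
  where
  bnd : Bounded N (blocks N a)
  bnd x x<N with ≤-<-connex a x
  ... | inj₂ x<a = <-≤-trans (blocks-below-< N x<a) a≤N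
  ... | inj₁ a≤x = blocks-above-< N a≤x x<N
  invol : ∀ x → x < N → blocks N a (blocks N a x) ≡ x
  invol x x<N with ≤-<-connex a x
  ... | inj₂ x<a = blocks-below-unique N (blocks-below-< N x<a)
        (trans (+-comm x _) (trans (sym (+-suc _ x)) (blocks-below N x<a)))
  ... | inj₁ a≤x = blocks-above-unique N (blocks-above-≥ N a≤x x<N) (blocks-above-< N a≤x x<N)
        (trans (+-comm x _) (trans (sym (+-suc _ x)) (blocks-above N a≤x x<N)))

m+n≡o+p∧n<p⇒o<m : ∀ {m n o p} → m + n ≡ o + p → n < p → o < m
m+n≡o+p∧n<p⇒o<m {m} {n} {o} {p} eq n<p with o <? m
... | yes o<m = o<m
... | no  o≮m = ⊥-elim (<-irrefl eq (+-mono-≤-< (≮⇒≥ o≮m) n<p))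

blocks-avoids : ∀ N a → Avoids N (blocks N a)
blocks-avoids N a i j k i<j j<k k<N bi<bj bj<bk with ≤-<-connex a j
... | inj₂ j<a = <-asym bi<bj (m+n≡o+p∧n<p⇒o<m
        (trans (blocks-below N (<-trans i<j j<a)) (sym (blocks-below N j<a))) (s≤s i<j))
... | inj₁ a≤j = <-asym bj<bk (m+n≡o+p∧n<p⇒o<m
        (trans (blocks-above N a≤j (<-trans j<k k<N))
               (sym (blocks-above N (≤-trans a≤j (<⇒≤ j<k)) k<N)))
        (s≤s j<k))

suc-suc-+ : ∀ {b i c} → b + suc i ≡ c → suc b + suc (suc i) ≡ suc (suc c)
suc-suc-+ {b} {i} eq = cong suc (trans (+-suc b (suc i)) (cong suc eq))

blocks-conj₁ : ∀ N i → i < N → blocks (suc N) 1 (suc i) ≡ suc (blocks N 0 i)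
blocks-conj₁ N i i<N = blocks-above-unique (suc N) (s≤s z≤n) (s≤s i<N)
  (trans (suc-suc-+ (blocks-above N z≤n i<N)) (cong suc (sym (+-suc N 0))))

blocks-conj₀ : ∀ N i → i < N →
  blocks (suc (suc N)) 0 (suc (punchIn N i)) ≡ suc (punchIn N (blocks N 0 i))
blocks-conj₀ N i i<N = begin
  B (suc (punchIn N i))           ≡⟨ cong (B ∘ suc) (punchIn-below N i i<N) ⟩
  B (suc i)                       ≡⟨ blocks-above-unique (suc (suc N)) z≤n (s≤s (m<n⇒m<1+n i<N))
                                       (suc-suc-+ (blocks-above N z≤n i<N)) ⟩
  suc (blocks N 0 i)              ≡⟨ cong suc (punchIn-below N _ (blocks-above-< N z≤n i<N)) ⟨
  suc (punchIn N (blocks N 0 i))  ∎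
  where
  open ≡-Reasoning
  B : ℕ → ℕ
  B = blocks (suc (suc N)) 0

blocks-conj : ∀ N a i → i < N →
  blocks (suc (suc N)) (suc (suc a)) (suc (punchIn a i)) ≡ suc (punchIn a (blocks N a i))
blocks-conj N a i i<N with ≤-<-connex a i
... | inj₂ i<a = begin
  B (suc (punchIn a i))           ≡⟨ cong (B ∘ suc) (punchIn-below a i i<a) ⟩
  B (suc i)                       ≡⟨ blocks-below-unique (suc (suc N)) (s≤s (m<n⇒m<1+n i<a))
                                       (suc-suc-+ (blocks-below N i<a)) ⟩
  suc (blocks N a i)              ≡⟨ cong suc (punchIn-below a _ (blocks-below-< N i<a)) ⟨
  suc (punchIn a (blocks N a i))  ∎
  where
  open ≡-Reasoning
  B : ℕ → ℕ
  B = blocks (suc (suc N)) (suc (suc a))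
... | inj₁ a≤i = begin
  B (suc (punchIn a i))           ≡⟨ cong (B ∘ suc) (punchIn-above a i a≤i) ⟩
  B (suc (suc i))                 ≡⟨ blocks-above-unique (suc (suc N)) (s≤s (s≤s a≤i)) (s≤s (s≤s i<N))
                                       sum≡ ⟩
  suc (suc (blocks N a i))        ≡⟨ cong suc (punchIn-above a _ (blocks-above-≥ N a≤i i<N)) ⟨
  suc (punchIn a (blocks N a i))  ∎
  where
  open ≡-Reasoning
  B : ℕ → ℕ
  B = blocks (suc (suc N)) (suc (suc a))
  sum≡ : suc (suc (blocks N a i)) + suc (suc (suc i)) ≡ suc (suc N) + suc (suc a)
  sum≡ = trans (suc-suc-+ {b = suc (blocks N a i)} (suc-suc-+ (blocks-above N a≤i i<N)))
               (cong (suc ∘ suc) (sym (trans (+-suc N (suc a)) (cong suc (+-suc N a)))))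

blocks-noCrossing : ∀ N a → NoCrossing N a (blocks N a)
blocks-noCrossing N a i i<N with ≤-<-connex a i
... | inj₁ a≤i = (λ b<a → ⊥-elim (<⇒≱ b<a (blocks-above-≥ N a≤i i<N))) ,
                 (λ i<a → ⊥-elim (<⇒≱ i<a a≤i))
... | inj₂ i<a = (λ _ → i<a) , (λ _ → blocks-below-< N i<a)

blocks-shallow : ∀ N a → a ≤ N → IsShallow N (blocks N a)
blocks-shallow zero          a             _   = refl
blocks-shallow (suc zero)    zero          _   = refl
blocks-shallow (suc N)       (suc zero)    _   =
  shallow-insert₁ (blocks-involution (suc N) (s≤s z≤n)) refl (blocks-conj₁ N) (blocks-shallow N 0 z≤n)
blocks-shallow (suc zero)    (suc (suc a)) (s≤s ())
blocks-shallow (suc (suc N)) zero          _   =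
  shallow-insert₂ (blocks-involution (suc (suc N)) z≤n) (cong suc (+-identityʳ N)) (blocks-conj₀ N)
    (NoCrossing-top (proj₁ (blocks-involution N z≤n))) (blocks-shallow N 0 z≤n)
blocks-shallow (suc (suc N)) (suc (suc a)) a≤N =
  shallow-insert₂ (blocks-involution (suc (suc N)) a≤N) refl (blocks-conj N a)
    (blocks-noCrossing N a) (blocks-shallow N a (s≤s⁻¹ (s≤s⁻¹ a≤N)))

blocks-shallowAvInv : ∀ N a → a ≤ N → ShallowAvInvOn N (blocks N a)
blocks-shallowAvInv N a a≤N = blocks-involution N a≤N , blocks-avoids N a , blocks-shallow N a a≤N

-- Classification

adjacent-values-differ : ∀ {N f} → Involution N f → ∀ {x} → suc x < N → f x ≢ f (suc x)
adjacent-values-differ inv {x} 1+x<N eq =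
  1+n≢n (sym (involution-injective inv (<-trans (n<1+n x) 1+x<N) 1+x<N eq))

descent-after : ∀ {N f} → Involution N f → Avoids N f →
  ∀ {i x} → i < x → suc x < N → f i < f x → f (suc x) < f x
descent-after {f = f} inv av {i} {x} i<x 1+x<N fi<fx with <-cmp (f x) (f (suc x))
... | tri< fx<f1+x _ _ = ⊥-elim (av i x (suc x) i<x (n<1+n x) 1+x<N fi<fx fx<f1+x)
... | tri≈ _ eq _      = ⊥-elim (adjacent-values-differ inv 1+x<N eq)
... | tri> _ _ gt      = gt

descent-before : ∀ {N f} → Involution N f → Avoids N f →
  ∀ {x z} → suc x < z → z < N → f (suc x) < f z → f (suc x) < f x
descent-before {f = f} inv av {x} {z} 1+x<z z<N f1+x<fz with <-cmp (f x) (f (suc x))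
... | tri< fx<f1+x _ _ = ⊥-elim (av x (suc x) z (n<1+n x) 1+x<z z<N fx<f1+x f1+x<fz)
... | tri≈ _ eq _      = ⊥-elim (adjacent-values-differ inv (<-trans 1+x<z z<N) eq)
... | tri> _ _ gt      = gt

antitone : ∀ (h : ℕ → ℕ) {a b} → (∀ x → a ≤ x → x < b → h (suc x) ≤ h x) →
           ∀ {x} y → a ≤ x → x ≤ y → y ≤ b → h y ≤ h x
antitone h step {x} y a≤x x≤y y≤b with m≤n⇒m<n∨m≡n x≤y
... | inj₂ refl = ≤-refl
antitone h step {x} (suc y) a≤x _ y<b | inj₁ x<1+y =
  ≤-trans (step y (≤-trans a≤x (s≤s⁻¹ x<1+y)) y<b) (antitone h step y a≤x (s≤s⁻¹ x<1+y) (<⇒≤ y<b))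

descending-run : ∀ (f : ℕ → ℕ) {a b c} → (∀ x → a ≤ x → x < b → f (suc x) < f x) →
  f a + a ≤ c → c ≤ f b + b → ∀ x → a ≤ x → x ≤ b → f x + x ≡ c
descending-run f {a} {b} {c} desc ≤c c≤ x a≤x x≤b = ≤-antisym
  (≤-trans (antitone h step x ≤-refl a≤x x≤b) ≤c)
  (≤-trans c≤ (antitone h step b a≤x x≤b ≤-refl))
  where
  h : ℕ → ℕ
  h x = f x + x
  step : ∀ x → a ≤ x → x < b → h (suc x) ≤ h x
  step x a≤x x<b = ≤-trans (≤-reflexive (+-suc (f (suc x)) x)) (+-monoˡ-≤ x (desc x a≤x x<b))

-- If f 0 = m and no arc joins (0, m) to (m, K], avoidance makes f decrease on [0, m] and on
-- (m, K], and the end values pin both runs down.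
module TwoRuns {K : ℕ} {f : ℕ → ℕ} {m : ℕ} (inv : Involution (suc K) f) (av : Avoids (suc K) f)
  (f0 : f 0 ≡ m) (m<K : m < K)
  (outer : ∀ x → m < x → x < suc K → m < f x) (inner : ∀ x → 0 < x → x < m → f x < m) where

  fm≡0 : f m ≡ 0
  fm≡0 = trans (cong f (sym f0)) (proj₂ inv 0 (s≤s z≤n))

  m<1+K : m < suc K
  m<1+K = <-trans m<K (n<1+n K)

  head : ∀ x → x ≤ m → f x + x ≡ m
  head x = descending-run f desc (≤-reflexive (trans (+-identityʳ (f 0)) f0))
                                 (≤-reflexive (cong (_+ m) (sym fm≡0))) x z≤n
    where
    desc : ∀ y → 0 ≤ y → y < m → f (suc y) < f y
    desc y _ y<m with m≤n⇒m<n∨m≡n y<m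
    ... | inj₂ refl = subst (_< f y) (sym fm≡0) (n≢0⇒n>0 (λ fy≡0 →
            1+n≢n (sym (involution-injective inv (<-trans y<m m<1+K) m<1+K (trans fy≡0 (sym fm≡0))))))
    ... | inj₁ 1+y<m = descent-before inv av (s≤s (<⇒≤ 1+y<m)) (s≤s m<K)
            (<-trans (inner (suc y) (s≤s z≤n) 1+y<m) (outer (suc m) (n<1+n m) (s≤s m<K)))

  tail : ∀ x → suc m ≤ x → x ≤ K → f x + x ≡ K + suc m
  tail = descending-run f desc
    (+-monoˡ-≤ (suc m) (s≤s⁻¹ (proj₁ inv (suc m) (s≤s m<K))))
    (subst (_≤ f K + K) (+-comm (suc m) K) (+-monoˡ-≤ K (outer K m<K (n<1+n K))))
    where
    desc : ∀ y → suc m ≤ y → y < K → f (suc y) < f y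
    desc y m<y y<K = descent-after inv av m<y (s≤s y<K)
      (subst (_< f y) (sym fm≡0) (≤-<-trans z≤n (outer y m<y (<-trans y<K (n<1+n K)))))

  ≈blocks : f ≈[ suc K ] blocks (suc K) (suc m)
  ≈blocks x x<1+K with ≤-<-connex (suc m) x
  ... | inj₂ x<1+m = sym (blocks-below-unique (suc K) x<1+m
          (trans (+-suc (f x) x) (cong suc (head x (s≤s⁻¹ x<1+m)))))
  ... | inj₁ 1+m≤x = sym (blocks-above-unique (suc K) 1+m≤x x<1+K
          (trans (+-suc (f x) x) (cong suc (tail x 1+m≤x (s≤s⁻¹ x<1+K)))))

classify : ∀ M {f} → ShallowAvInvOn (suc (suc M)) f →
  (f 0 ≡ suc M × ShallowAvInvOn M (delete₂ M f)) ⊎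
  (∃ λ q → q ≤ M × f ≈[ suc (suc M) ] blocks (suc (suc M)) (suc q))
classify M {f} (inv , av , sh) with zero-or-suc (f 0)
... | inj₁ f0 = inj₂ (0 , z≤n , TwoRuns.≈blocks inv av f0 (s≤s z≤n) outer (λ _ _ ()))
  where
  outer : ∀ x → 0 < x → x < suc (suc M) → 0 < f x
  outer x 0<x x<N = n≢0⇒n>0 (λ fx≡0 →
    n>0⇒n≢0 0<x (involution-injective inv x<N (s≤s z≤n) (trans fx≡0 (sym f0))))
... | inj₂ (p , f0) with m≤n⇒m<n∨m≡n (Delete₂.p≤N inv f0)
...   | inj₂ refl =
  inj₁ (f0 , involution , avoids av , proj₂ (Equivalence.to (shallow-delete₂⇔ inv f0) sh))
  where open Delete₂ inv f0
...   | inj₁ p<M  =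
  inj₂ (suc p , p<M , TwoRuns.≈blocks inv av f0 (s≤s p<M) (noCrossing-outer nc) (noCrossing-inner nc))
  where
  open Delete₂ inv f0
  nc : NoCrossing M p (delete₂ p f)
  nc = proj₁ (Equivalence.to (shallow-delete₂⇔ inv f0) sh)

-- From words to functions

fun : ∀ {n} → Word n → ℕ → ℕ
fun {n} v i with i <? n
... | yes i<n = val v (fromℕ< i<n)
... | no  _   = 0

fun-< : ∀ {n} (v : Word n) {i} (i<n : i < n) → fun v i ≡ val v (fromℕ< i<n)
fun-< {n} v {i} i<n with i <? n
... | yes _   = refl
... | no  i≮n = ⊥-elim (i≮n i<n)

fun-toℕ : ∀ {n} (v : Word n) (i : Fin n) → fun v (toℕ i) ≡ val v i
fun-toℕ v i = trans (fun-< v (Fin.toℕ<n i)) (cong (val v) (Fin.fromℕ<-toℕ i (Fin.toℕ<n i)))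

fun-bounded : ∀ {n} (v : Word n) → Bounded n (fun v)
fun-bounded v i i<n = subst (_< _) (sym (fun-< v i<n)) (Fin.toℕ<n _)

fun-injective : ∀ {n} (v u : Word n) → fun v ≈[ n ] fun u → v ≡ u
fun-injective v u v≈u = begin
  v                   ≡⟨ Vec.tabulate∘lookup v ⟨
  tabulate (lookup v) ≡⟨ Vec.tabulate-cong lookup≗ ⟩
  tabulate (lookup u) ≡⟨ Vec.tabulate∘lookup u ⟩
  u                   ∎
  where
  open ≡-Reasoning
  lookup≗ : ∀ i → lookup v i ≡ lookup u i
  lookup≗ i = Fin.toℕ-injective
    (trans (sym (fun-toℕ v i)) (trans (v≈u (toℕ i) (Fin.toℕ<n i)) (fun-toℕ u i)))

fromFun : ∀ M (g : ℕ → ℕ) → Bounded M g → Word M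
fromFun M g bnd = tabulate (λ i → fromℕ< (bnd (toℕ i) (Fin.toℕ<n i)))

fun-fromFun : ∀ M g (bnd : Bounded M g) → fun (fromFun M g bnd) ≈[ M ] g
fun-fromFun M g bnd i i<M = begin
  fun (fromFun M g bnd) i                               ≡⟨ fun-< (fromFun M g bnd) i<M ⟩
  toℕ (lookup (fromFun M g bnd) (fromℕ< i<M))           ≡⟨ cong toℕ (Vec.lookup∘tabulate _ j) ⟩
  toℕ (fromℕ< (bnd (toℕ (fromℕ< i<M)) (Fin.toℕ<n _)))  ≡⟨ Fin.toℕ-fromℕ< _ ⟩
  g (toℕ (fromℕ< i<M))                                  ≡⟨ cong g (Fin.toℕ-fromℕ< i<M) ⟩
  g i                                                   ∎
  where
  open ≡-Reasoning
  j : Fin M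
  j = fromℕ< i<M

involution⇔ : ∀ {n} (v : Word n) → IsInvolution v ⇔ Involution n (fun v)
involution⇔ {n} v = mk⇔ to from
  where
  to : IsInvolution v → Involution n (fun v)
  to invol = fun-bounded v , λ i i<n → begin
    fun v (fun v i)                            ≡⟨ cong (fun v) (fun-< v i<n) ⟩
    fun v (val v (fromℕ< i<n))                 ≡⟨ fun-toℕ v (lookup v (fromℕ< i<n)) ⟩
    toℕ (lookup v (lookup v (fromℕ< i<n)))     ≡⟨ cong toℕ (invol (fromℕ< i<n)) ⟩
    toℕ (fromℕ< i<n)                           ≡⟨ Fin.toℕ-fromℕ< i<n ⟩
    i                                          ∎
    where open ≡-Reasoning
  from : Involution n (fun v) → IsInvolution v
  from (_ , invol) i = Fin.toℕ-injective (begin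
    toℕ (lookup v (lookup v i))  ≡⟨ fun-toℕ v (lookup v i) ⟨
    fun v (val v i)              ≡⟨ cong (fun v) (fun-toℕ v i) ⟨
    fun v (fun v (toℕ i))        ≡⟨ invol (toℕ i) (Fin.toℕ<n i) ⟩
    toℕ i                        ∎)
    where open ≡-Reasoning

involution⇒perm : ∀ {n} (v : Word n) → IsInvolution v → IsPerm v
involution⇒perm v invol i j eq = trans (sym (invol i)) (trans (cong (lookup v) eq) (invol j))

avoids⇔ : ∀ {n} (v : Word n) → Avoids123 v ⇔ Avoids n (fun v)
avoids⇔ {n} v = mk⇔ to from
  where
  to : Avoids123 v → Avoids n (fun v)
  to av i j k i<j j<k k<n fi<fj fj<fk =
    av (fromℕ< i<n) (fromℕ< j<n) (fromℕ< k<n)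
      (subst₂ _<_ (sym (Fin.toℕ-fromℕ< i<n)) (sym (Fin.toℕ-fromℕ< j<n)) i<j)
      (subst₂ _<_ (sym (Fin.toℕ-fromℕ< j<n)) (sym (Fin.toℕ-fromℕ< k<n)) j<k)
      (subst₂ _<_ (fun-< v i<n) (fun-< v j<n) fi<fj , subst₂ _<_ (fun-< v j<n) (fun-< v k<n) fj<fk)
    where
    j<n : j < n
    j<n = <-trans j<k k<n
    i<n : i < n
    i<n = <-trans i<j j<n
  from : Avoids n (fun v) → Avoids123 v
  from av i j k i<j j<k (vi<vj , vj<vk) =
    av (toℕ i) (toℕ j) (toℕ k) i<j j<k (Fin.toℕ<n k)
      (subst₂ _<_ (sym (fun-toℕ v i)) (sym (fun-toℕ v j)) vi<vj)
      (subst₂ _<_ (sym (fun-toℕ v j)) (sym (fun-toℕ v k)) vj<vk)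

-- sumFin sums with a where-bound function that cannot be named here; abstracting allFin n
-- lets the first argument of foldr-universal be solved as that function.
sumFin≡sum : ∀ {n} (f : Fin n → ℕ) → sumFin f ≡ sum (map f (allFin n))
sumFin≡sum {n} f with allFin n | List.foldr-universal _ (λ x s → f x + s) 0 refl (λ _ _ → refl)
... | xs | sumFin-go≗foldr =
  trans (sumFin-go≗foldr xs) (sym (List.foldr-universal (sum ∘ map f) _ 0 refl (λ _ _ → refl) xs))

dist≡∣-∣ : ∀ a b → dist a b ≡ ∣ a - b ∣
dist≡∣-∣ zero    zero    = refl
dist≡∣-∣ zero    (suc b) = refl
dist≡∣-∣ (suc a) zero    = +-identityʳ (suc a)
dist≡∣-∣ (suc a) (suc b) = dist≡∣-∣ a b

Dstat≡D : ∀ {n} (v : Word n) → Dstat v ≡ D n (fun v)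
Dstat≡D {n} v = trans (sumFin≡sum (λ i → dist (val v i) (toℕ i))) (sum-allFin n _ (λ i →
  trans (dist≡∣-∣ (val v i) (toℕ i)) (cong (λ a → ∣ a - toℕ i ∣) (sym (fun-toℕ v i)))))

Istat≡I : ∀ {n} (v : Word n) → Istat v ≡ I n (fun v)
Istat≡I {n} v =
  trans (length-filter _ (cartesianProduct (allFin n) (allFin n)))
  (trans (sum-cartesianProduct _ (allFin n) (allFin n))
         (sum-allFin n _ (λ i → sum-allFin n _ (λ j → χ-cong _ (inversion? (fun v) (toℕ i) (toℕ j))
           (λ (i<j , vj<vi) → i<j , subst₂ _<_ (sym (fun-toℕ v j)) (sym (fun-toℕ v i)) vj<vi)
           (λ (i<j , fj<fi) → i<j , subst₂ _<_ (fun-toℕ v j) (fun-toℕ v i) fj<fi)))))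

iter-involution : ∀ {n} (v : Word n) → IsInvolution v →
                  ∀ k i → iter v k i ≡ i ⊎ iter v k i ≡ lookup v i
iter-involution v invol zero    i = inj₁ refl
iter-involution v invol (suc k) i with iter-involution v invol k i
... | inj₁ eq = inj₂ (cong (lookup v) eq)
... | inj₂ eq = inj₁ (trans (cong (lookup v) eq) (invol i))

cycleMin⇔ : ∀ {n} (v : Word n) → IsInvolution v → ∀ i → IsCycleMin v i ⇔ toℕ i ≤ val v i
cycleMin⇔ {suc n} v invol i = mk⇔ (λ isMin → isMin Fin.zero) from
  where
  from : toℕ i ≤ val v i → IsCycleMin v i
  from i≤vi k with iter-involution v invol (suc (toℕ k)) i
  ... | inj₁ eq = ≤-reflexive (cong toℕ (sym eq))
  ... | inj₂ eq = subst (λ w → toℕ i ≤ toℕ w) (sym eq) i≤vi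

χ-≤+χ-> : ∀ a b → χ (a ≤? b) + χ (b <? a) ≡ 1
χ-≤+χ-> a b with a ≤? b
... | yes a≤b = cong suc (χ-no (b <? a) (≤⇒≯ a≤b))
... | no  a≰b = χ-yes (b <? a) (≰⇒> a≰b)

Tstat≡T : ∀ {n} (v : Word n) → IsInvolution v → Tstat v ≡ T n (fun v)
Tstat≡T {n} v invol = begin
  n ∸ cyc v             ≡⟨ cong (n ∸_) cyc≡ ⟩
  n ∸ X                 ≡⟨ cong (_∸ X) partition ⟨
  X + T n (fun v) ∸ X   ≡⟨ m+n∸m≡n X _ ⟩
  T n (fun v)           ∎
  where
  open ≡-Reasoning
  X : ℕ
  X = ∑ n (λ i → χ (i ≤? fun v i))
  cyc≡ : cyc v ≡ X
  cyc≡ = trans (length-filter (isCycleMin? v) (allFin n)) (sum-allFin n _ (λ i →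
    χ-cong (isCycleMin? v i) (toℕ i ≤? fun v (toℕ i))
      (λ isMin → subst (toℕ i ≤_) (sym (fun-toℕ v i)) (Equivalence.to (cycleMin⇔ v invol i) isMin))
      (λ i≤fi → Equivalence.from (cycleMin⇔ v invol i) (subst (toℕ i ≤_) (fun-toℕ v i) i≤fi))))
  partition : X + T n (fun v) ≡ n
  partition = trans (sym (∑-distrib-+ n _ _))
                    (trans (∑-cong n (λ i _ → χ-≤+χ-> i (fun v i))) (∑-const-1 n))

shallowAvInv⇔ : ∀ {n} (v : Word n) → ShallowAvInv v ⇔ ShallowAvInvOn n (fun v)
shallowAvInv⇔ {n} v = mk⇔ to from
  where
  stats : IsInvolution v → Istat v + Tstat v ≡ I n (fun v) + T n (fun v)
  stats invol = cong₂ _+_ (Istat≡I v) (Tstat≡T v invol)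
  to : ShallowAvInv v → ShallowAvInvOn n (fun v)
  to (_ , invol , av , sh) = Equivalence.to (involution⇔ v) invol , Equivalence.to (avoids⇔ v) av ,
                             trans (sym (stats invol)) (trans sh (Dstat≡D v))
  from : ShallowAvInvOn n (fun v) → ShallowAvInv v
  from (inv , av , sh) = involution⇒perm v invol , invol , Equivalence.from (avoids⇔ v) av ,
                         trans (stats invol) (trans sh (sym (Dstat≡D v)))
    where
    invol : IsInvolution v
    invol = Equivalence.from (involution⇔ v) inv

-- Counting

1+q≤2+M : ∀ {M} (q : Fin (suc M)) → suc (toℕ q) ≤ suc (suc M)
1+q≤2+M q = s≤s (<⇒≤ (Fin.toℕ<n q))

wrapWord : ∀ M → Word M → Word (suc (suc M))
wrapWord M u = fromFun (suc (suc M)) (wrap M (fun u)) (wrap-bounded M (fun-bounded u))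

blocksWord : ∀ M → Fin (suc M) → Word (suc (suc M))
blocksWord M q = fromFun (suc (suc M)) (blocks (suc (suc M)) (suc (toℕ q)))
                   (proj₁ (blocks-involution (suc (suc M)) (1+q≤2+M q)))

fun-wrapWord : ∀ M u → fun (wrapWord M u) ≈[ suc (suc M) ] wrap M (fun u)
fun-wrapWord M u = fun-fromFun (suc (suc M)) _ (wrap-bounded M (fun-bounded u))

fun-blocksWord : ∀ M q → fun (blocksWord M q) ≈[ suc (suc M) ] blocks (suc (suc M)) (suc (toℕ q))
fun-blocksWord M q = fun-fromFun (suc (suc M)) _ (proj₁ (blocks-involution (suc (suc M)) (1+q≤2+M q)))

fun-blocksWord-0 : ∀ M q → fun (blocksWord M q) 0 ≡ toℕ q
fun-blocksWord-0 M q = trans (fun-blocksWord M q 0 (s≤s z≤n))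
                             (blocks-below-unique (suc (suc M)) (s≤s z≤n) (+-comm (toℕ q) 1))

-- blocks (M+2) 0 is the reversal, which wrap already produces; so the runs start at a = 1 … M+1.
shallowAvInvs : ∀ N → List (Word N)
shallowAvInvs zero          = Vec.[] ∷ []
shallowAvInvs (suc zero)    = (Fin.zero Vec.∷ Vec.[]) ∷ []
shallowAvInvs (suc (suc M)) =
  map (wrapWord M) (shallowAvInvs M) ++ map (blocksWord M) (allFin (suc M))

shallowAvInvs-sound : ∀ N (v : Word N) → v ∈ shallowAvInvs N → ShallowAvInvOn N (fun v)
shallowAvInvs-sound zero       _ (here refl) =
  ShallowAvInvOn-cong 0 (λ _ ()) (blocks-shallowAvInv 0 0 z≤n)
shallowAvInvs-sound (suc zero) _ (here refl) =
  ShallowAvInvOn-cong 1 (λ { zero _ → refl ; (suc _) (s≤s ()) }) (blocks-shallowAvInv 1 0 z≤n)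
shallowAvInvs-sound (suc (suc M)) v v∈ with ∈-++⁻ (map (wrapWord M) (shallowAvInvs M)) v∈
... | inj₁ v∈wraps with ∈-map⁻ (wrapWord M) v∈wraps
...   | u , u∈ , refl = ShallowAvInvOn-cong (suc (suc M))
          (λ i i<N → sym (fun-wrapWord M u i i<N))
          (wrap-shallowAvInv M (shallowAvInvs-sound M u u∈))
shallowAvInvs-sound (suc (suc M)) v v∈ | inj₂ v∈blocks with ∈-map⁻ (blocksWord M) v∈blocks
...   | q , _ , refl = ShallowAvInvOn-cong (suc (suc M))
          (λ i i<N → sym (fun-blocksWord M q i i<N))
          (blocks-shallowAvInv (suc (suc M)) (suc (toℕ q)) (1+q≤2+M q))

shallowAvInvs-complete : ∀ N (v : Word N) → ShallowAvInvOn N (fun v) → v ∈ shallowAvInvs N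
shallowAvInvs-complete zero          Vec.[]                  _ = here refl
shallowAvInvs-complete (suc zero)    (Fin.zero Vec.∷ Vec.[]) _ = here refl
shallowAvInvs-complete (suc (suc M)) v sai with classify M sai
... | inj₁ (f0 , sai′) =
  subst (_∈ shallowAvInvs (suc (suc M))) (sym v≡)
    (∈-++⁺ˡ (∈-map⁺ (wrapWord M) (shallowAvInvs-complete M u (ShallowAvInvOn-cong M u≈ sai′))))
  where
  g : ℕ → ℕ
  g = delete₂ M (fun v)
  g-bounded : Bounded M g
  g-bounded = proj₁ (proj₁ sai′)
  u : Word M
  u = fromFun M g g-bounded
  u≈ : g ≈[ M ] fun u
  u≈ i i<M = sym (fun-fromFun M g g-bounded i i<M)
  v≡ : v ≡ wrapWord M u
  v≡ = fun-injective v (wrapWord M u) (λ i i<N → begin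
    fun v i                 ≡⟨ wrap-delete₂ M (proj₁ sai) f0 i i<N ⟨
    wrap M g i              ≡⟨ wrap-cong M u≈ i i<N ⟩
    wrap M (fun u) i        ≡⟨ fun-wrapWord M u i i<N ⟨
    fun (wrapWord M u) i    ∎)
    where open ≡-Reasoning
... | inj₂ (q , q≤M , v≈) =
  subst (_∈ shallowAvInvs (suc (suc M))) (sym v≡)
    (∈-++⁺ʳ (map (wrapWord M) (shallowAvInvs M)) (∈-map⁺ (blocksWord M) (∈-allFin q′)))
  where
  q′ : Fin (suc M)
  q′ = fromℕ< (s≤s q≤M)
  v≡ : v ≡ blocksWord M q′
  v≡ = fun-injective v (blocksWord M q′) (λ i i<N → begin
    fun v i                                ≡⟨ v≈ i i<N ⟩
    blocks (suc (suc M)) (suc q) i         ≡⟨ cong (λ a → blocks (suc (suc M)) (suc a) i)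
                                                   (Fin.toℕ-fromℕ< (s≤s q≤M)) ⟨
    blocks (suc (suc M)) (suc (toℕ q′)) i  ≡⟨ fun-blocksWord M q′ i i<N ⟨
    fun (blocksWord M q′) i                ∎)
    where open ≡-Reasoning

shallowAvInvs-unique : ∀ N → Unique (shallowAvInvs N)
shallowAvInvs-unique zero          = All.[] AllPairs.∷ AllPairs.[]
shallowAvInvs-unique (suc zero)    = All.[] AllPairs.∷ AllPairs.[]
shallowAvInvs-unique (suc (suc M)) =
  Unique.++⁺ (Unique.map⁺ wrapWord-injective (shallowAvInvs-unique M))
             (Unique.map⁺ blocksWord-injective (Unique.allFin⁺ (suc M)))
             disjoint
  where
  wrapWord-suc : ∀ u {i} → i < M → fun (wrapWord M u) (suc i) ≡ suc (fun u i)
  wrapWord-suc u i<M = trans (fun-wrapWord M u _ (s≤s (m<n⇒m<1+n i<M))) (wrap-suc M (fun u) i<M)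
  wrapWord-injective : ∀ {u u′} → wrapWord M u ≡ wrapWord M u′ → u ≡ u′
  wrapWord-injective {u} {u′} eq = fun-injective u u′ (λ i i<M → suc-injective
    (trans (sym (wrapWord-suc u i<M)) (trans (cong (λ w → fun w (suc i)) eq) (wrapWord-suc u′ i<M))))
  blocksWord-injective : ∀ {q q′} → blocksWord M q ≡ blocksWord M q′ → q ≡ q′
  blocksWord-injective {q} {q′} eq = Fin.toℕ-injective
    (trans (sym (fun-blocksWord-0 M q)) (trans (cong (λ w → fun w 0) eq) (fun-blocksWord-0 M q′)))
  disjoint : Disjoint (map (wrapWord M) (shallowAvInvs M)) (map (blocksWord M) (allFin (suc M)))
  disjoint (w∈wraps , w∈blocks) with ∈-map⁻ (wrapWord M) w∈wraps | ∈-map⁻ (blocksWord M) w∈blocks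
  ... | u , _ , refl | q , _ , eq = <-irrefl q≡1+M (Fin.toℕ<n q)
    where
    q≡1+M : toℕ q ≡ suc M
    q≡1+M = trans (sym (fun-blocksWord-0 M q))
                  (trans (cong (λ w → fun w 0) (sym eq)) (fun-wrapWord M u 0 (s≤s z≤n)))

words-complete : ∀ n m (v : Vec (Fin n) m) → v ∈ words n m
words-complete n zero    Vec.[]         = here refl
words-complete n (suc m) (x Vec.∷ v) =
  ∈-concat⁺′ (∈-map⁺ (x Vec.∷_) (words-complete n m v))
             (∈-map⁺ (λ y → map (y Vec.∷_) (words n m)) (∈-allFin x))

words-unique : ∀ n m → Unique (words n m)
words-unique n zero    = All.[] AllPairs.∷ AllPairs.[]
words-unique n (suc m) = Unique.concat⁺
  (All.map⁺ (All.universal (λ _ → Unique.map⁺ Vec.∷-injectiveʳ (words-unique n m)) (allFin n)))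
  (AllPairs.map⁺ (AllPairs.map disjoint (Unique.allFin⁺ n)))
  where
  disjoint : ∀ {x y : Fin n} → x ≢ y →
             Disjoint (map (x Vec.∷_) (words n m)) (map (y Vec.∷_) (words n m))
  disjoint x≢y (v∈x , v∈y) with ∈-map⁻ _ v∈x | ∈-map⁻ _ v∈y
  ... | _ , _ , refl | _ , _ , eq = x≢y (Vec.∷-injectiveˡ eq)

length-filter-↭ : ∀ {A : Set} {P : A → Set} (P? : Decidable P) {xs ys : List A} →
  Unique xs → (∀ x → x ∈ xs) → Unique ys → (∀ y → P y ⇔ y ∈ ys) → length (filter P? xs) ≡ length ys
length-filter-↭ P? {xs} {ys} xs! xs-all ys! P⇔∈ =
  ↭-length (∼bag⇒↭ (unique∧set⇒bag (Unique.filter⁺ P? xs!) ys! (λ {y} → mk⇔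
    (λ y∈ → Equivalence.to (P⇔∈ y) (proj₂ (∈-filter⁻ P? {xs = xs} y∈)))
    (λ y∈ → ∈-filter⁺ P? (xs-all y) (Equivalence.from (P⇔∈ y) y∈)))))

countShallowAvInv≡ : ∀ N → countShallowAvInv N ≡ length (shallowAvInvs N)
countShallowAvInv≡ N = length-filter-↭ shallowAvInv? (words-unique N N) (words-complete N N)
  (shallowAvInvs-unique N) (λ v → mk⇔
    (λ sai → shallowAvInvs-complete N v (Equivalence.to (shallowAvInv⇔ v) sai))
    (λ v∈ → Equivalence.from (shallowAvInv⇔ v) (shallowAvInvs-sound N v v∈)))

[2+M]²/4≡M²/4+1+M : ∀ M → suc (suc M) * suc (suc M) / 4 ≡ M * M / 4 + suc M
[2+M]²/4≡M²/4+1+M M = begin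
  suc (suc M) * suc (suc M) / 4   ≡⟨ cong (_/ 4) (expand M) ⟩
  (M * M + suc M * 4) / 4         ≡⟨ +-distrib-/-∣ʳ (M * M) (divides (suc M) refl) ⟩
  M * M / 4 + suc M * 4 / 4       ≡⟨ cong (M * M / 4 +_) (m*n/n≡m (suc M) 4) ⟩
  M * M / 4 + suc M               ∎
  where
  open ≡-Reasoning
  expand : ∀ M → suc (suc M) * suc (suc M) ≡ M * M + suc M * 4
  expand = solve-∀

length-shallowAvInvs : ∀ N → length (shallowAvInvs N) ≡ N * N / 4 + 1
length-shallowAvInvs zero          = refl
length-shallowAvInvs (suc zero)    = refl
length-shallowAvInvs (suc (suc M)) = begin
  length (map (wrapWord M) (shallowAvInvs M) ++ map (blocksWord M) (allFin (suc M)))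
    ≡⟨ List.length-++ (map (wrapWord M) (shallowAvInvs M)) ⟩
  length (map (wrapWord M) (shallowAvInvs M)) + length (map (blocksWord M) (allFin (suc M)))
    ≡⟨ cong₂ _+_ (trans (List.length-map (wrapWord M) (shallowAvInvs M)) (length-shallowAvInvs M))
                 (trans (List.length-map (blocksWord M) (allFin (suc M))) (List.length-tabulate id)) ⟩
  M * M / 4 + 1 + suc M
    ≡⟨ a+1+b≡a+b+1 (M * M / 4) (suc M) ⟩
  M * M / 4 + suc M + 1
    ≡⟨ cong (_+ 1) ([2+M]²/4≡M²/4+1+M M) ⟨
  suc (suc M) * suc (suc M) / 4 + 1
    ∎
  where
  open ≡-Reasoning
  a+1+b≡a+b+1 : ∀ a b → a + 1 + b ≡ a + b + 1
  a+1+b≡a+b+1 = solve-∀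

theorem5p4 : ∀ (n : ℕ) → 1 ≤ n → countShallowAvInv n ≡ (n * n) / 4 + 1
theorem5p4 n _ = trans (countShallowAvInv≡ n) (length-shallowAvInvs n)
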